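{- Let $z:[n]\to[k]$ be a non-decreasing map and let $\gamma\in\ker_{\mathbb Z}A_{n,z}$ be nonzero. Then there exist two edges $uv,u'v'$ of $K_n$, non-intersecting in the standard convex embedding of $K_n$, with $z(u)=z(u')$, such that $x_{uv}x_{u'v'}$ divides $x^{\gamma^+}$ or $x^{\gamma^- }$.
   Context: Coordinates of $\mathbb Z^{\binom n2}$ and variables $x_{uv}$ are indexed by 2-subsets $\{u,v\}$ of $[n]$; $\gamma^\pm=\max(\pm\gamma,0)$ entrywise and $x^\alpha=\prod x_{uv}^{\alpha_{uv}}$. $A_{n,z}$ is the matrix obtained by stacking the vertex-edge incidence matrix of $K_n$ on top of the $\binom{k+1}2\times\binom n2$ matrix whose rows are indexed by pairs $(i,j)$, $1\le i\le j\le k$, and whose column $\{u,v\}$ has a single $1$ in row $(\min(z(u),z(v)),\max(z(u),z(v)))$. The standard convex embedding of $K_n$ places vertex $i$ at the $i$-th vertex (clockwise) of a regular $n$-gon, edges drawn as straight segments; two edges are non-intersecting if their segments are disjoint (in particular they share no endpoint). -}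

module Defs where

open import Data.Nat using (ℕ; zero; suc)
import Data.Nat as ℕ
open import Data.Integer using (ℤ; 0ℤ; _+_; -_; ∣_∣; _⊔_)
open import Data.Fin using (Fin; zero; suc; _<_; _≤_)
open import Data.Fin.Properties using (_<?_; _≤?_; _≟_)
open import Data.Product using (Σ; _×_; _,_; proj₁; proj₂; ∃)
open import Data.Sum using (_⊎_)
open import Relation.Nullary using (¬_; Dec; yes; no)
open import Relation.Nullary.Decidable using (_×-dec_; _⊎-dec_)
open import Relation.Binary.PropositionalEquality using (_≡_; _≢_)
open import Function.Bundles using (_⇔_)

sumFin : {n : ℕ} → (Fin n → ℤ) → ℤ
sumFin {zero}  f = 0ℤ
sumFin {suc n} f = f zero + sumFin (λ i → f (suc i))

-- 2-subsets {u,v} of [n], represented as (u , v) with u < v.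
Edge : ℕ → Set
Edge n = Σ (Fin n × Fin n) (λ p → proj₁ p < proj₂ p)

edgeSum : {n : ℕ} → (Edge n → ℤ) → ℤ
edgeSum {n} f = sumFin (λ u → sumFin (λ v → term u v (u <? v)))
  where
  term : (u v : Fin n) → Dec (u < v) → ℤ
  term u v (yes p) = f ((u , v) , p)
  term u v (no _)  = 0ℤ

edgeSumWhere : {n : ℕ} → (P : Edge n → Set) → ((e : Edge n) → Dec (P e)) →
               (Edge n → ℤ) → ℤ
edgeSumWhere P P? f = edgeSum (λ e → sel e (P? e))
  where
  sel : (e : Edge _) → Dec (P e) → ℤ
  sel e (yes _) = f e
  sel e (no _)  = 0ℤ

incident : {n : ℕ} → Fin n → Edge n → Set
incident w ((u , v) , _) = (w ≡ u) ⊎ (w ≡ v)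

incident? : {n : ℕ} (w : Fin n) (e : Edge n) → Dec (incident w e)
incident? w ((u , v) , _) = (w ≟ u) ⊎-dec (w ≟ v)

minF maxF : {k : ℕ} → Fin k → Fin k → Fin k
minF a b with a ≤? b
... | yes _ = a
... | no  _ = b
maxF a b with a ≤? b
... | yes _ = b
... | no  _ = a

-- column {u,v} of the lower block of A_{n,z} has its 1 in row (i,j)
inRow : {n k : ℕ} → (Fin n → Fin k) → Fin k → Fin k → Edge n → Set
inRow z i j ((u , v) , _) = (minF (z u) (z v) ≡ i) × (maxF (z u) (z v) ≡ j)

inRow? : {n k : ℕ} (z : Fin n → Fin k) (i j : Fin k) (e : Edge n) → Dec (inRow z i j e)
inRow? z i j ((u , v) , _) = (minF (z u) (z v) ≟ i) ×-dec (maxF (z u) (z v) ≟ j)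

-- γ ∈ ker_ℤ A_{n,z}: every row of the stacked matrix A_{n,z} annihilates γ.
InKernel : {n k : ℕ} → (Fin n → Fin k) → (Edge n → ℤ) → Set
InKernel {n} {k} z γ =
  ((w : Fin n) → edgeSumWhere (incident w) (incident? w) γ ≡ 0ℤ) ×
  ((i j : Fin k) → i ≤ j → edgeSumWhere (inRow z i j) (inRow? z i j) γ ≡ 0ℤ)

NonDecreasing : {n k : ℕ} → (Fin n → Fin k) → Set
NonDecreasing z = ∀ a b → a ≤ b → z a ≤ z b

-- Monomials x^α in the variables x_e (e ∈ Edge n), as exponent vectors.
Monomial : ℕ → Set
Monomial n = Edge n → ℕ

var : {n : ℕ} → Fin n → Fin n → Monomial n
var u v ((a , b) , _) = ind ((a ≟ u ×-dec b ≟ v) ⊎-dec (a ≟ v ×-dec b ≟ u))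
  where
  ind : {P : Set} → Dec P → ℕ
  ind (yes _) = 1
  ind (no _)  = 0

_·_ : {n : ℕ} → Monomial n → Monomial n → Monomial n
(α · β) e = α e ℕ.+ β e

_∣ₘ_ : {n : ℕ} → Monomial n → Monomial n → Set
α ∣ₘ β = ∀ e → α e ℕ.≤ β e

pos neg : {n : ℕ} → (Edge n → ℤ) → Monomial n
pos γ e = ∣ γ e ⊔ 0ℤ ∣
neg γ e = ∣ (- γ e) ⊔ 0ℤ ∣

-- Standard convex embedding: vertex i at the i-th vertex of a regular n-gon.
-- x lies strictly on one arc between a and b (the arc of indices strictly between them).
between : {n : ℕ} → Fin n → Fin n → Fin n → Set
between a x b = (a < x × x < b) ⊎ (b < x × x < a)

-- Segments uv and u'v' are disjoint: no shared endpoint and they do not cross,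
-- i.e. u' and v' lie on the same side (arc) of the chord uv.
NonIntersecting : {n : ℕ} → Fin n → Fin n → Fin n → Fin n → Set
NonIntersecting u v u' v' =
  (u ≢ u') × (u ≢ v') × (v ≢ u') × (v ≢ v') ×
  (between u u' v ⇔ between u v' v)

{-# OPTIONS --safe #-}
module Submission where

open import Defs
open import Data.Nat using (ℕ)
open import Data.Integer using (ℤ; 0ℤ)
open import Data.Fin using (Fin)
open import Data.Product using (Σ; _×_; _,_; ∃)
open import Data.Sum using (_⊎_)
open import Relation.Binary.PropositionalEquality using (_≡_; _≢_)

open import Data.Nat using (zero; suc; z≤n; s≤s)
import Data.Nat as ℕ
import Data.Nat.Properties as ℕ
open import Data.Integer using (1ℤ; -1ℤ; _+_; _*_; -_; _≤_; _<_; ∣_∣; _⊔_; +[1+_]; -[1+_])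
import Data.Integer as ℤ
import Data.Integer.Properties as ℤ
open import Data.Fin using (zero; suc)
import Data.Fin as F
import Data.Fin.Properties as F
open import Data.Fin.Properties using (_≟_; _<?_; _≤?_; any?)
open import Data.Bool using (if_then_else_)
open import Data.Product using (∃₂; proj₁; proj₂)
open import Data.Sum using (inj₁; inj₂; [_,_]′)
open import Data.Empty using (⊥; ⊥-elim)
open import Function using (_∘_)
open import Function.Bundles using (_⇔_; mk⇔; Equivalence)
open import Relation.Nullary using (Dec; does; yes; no; ¬_; ¬?; contradiction)
open import Relation.Nullary.Decidable using (_×-dec_; _⊎-dec_; _→-dec_; map′; dec-true; dec-false)
open import Relation.Binary.PropositionalEquality using (refl; sym; trans; cong; cong₂; subst; ≢-sym; module ≡-Reasoning)
open import Relation.Binary.Definitions using (Tri; tri<; tri≈; tri>)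
open import Algebra.Properties.Semiring.Sum ℤ.+-*-semiring
  using (sum; sum-cong-≗; ∑-distrib-+; ∑-comm; sum-replicate-zero; *-distribˡ-sum; *-distribʳ-sum)

-- Extend γ by zero to an array Γ on ordered pairs of vertices. Since γ is killed by every row
-- of A_{n,z}, it is killed by every combination of rows: ∑ (α p + α q + β (z p) (z q)) Γ p q = 0
-- for all vertex weights α and colour-pair weights β. So no such weight is a certificate, i.e.
-- has nonnegative products with Γ everywhere and a positive one somewhere.
--
-- Call two disjoint chords sharing a colour and carrying entries of Γ of equal sign a witness;
-- a witness gives the two variables of the theorem. Assuming there is none, we build a
-- certificate, replacing γ by -γ where a sign has to be fixed.
--  * If a support chord is monochromatic, take one (xm, ym) with xm largest and then ym
--    smallest; it is the only support chord inside [xm, ym].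
--  * Otherwise let (a, u) be the least support chord. Its vertex row and its colour row
--    (z a, z u) produce negative chords (a, w) and (x′, y′) with z x′ = z a, z y′ = z u, and
--    y′ least. If u = y′ these two chords form a witness, else a threshold at min(u, y′) in
--    colour z u gives a certificate.

𝟙 : {P : Set} → Dec P → ℤ
𝟙 d = if does d then 1ℤ else 0ℤ

𝟙-comm : {n : ℕ} (x y : Fin n) → 𝟙 (x ≟ y) ≡ 𝟙 (y ≟ x)
𝟙-comm x y with x ≟ y | y ≟ x
... | yes _   | yes _   = refl
... | yes x≡y | no  y≢x = contradiction (sym x≡y) y≢x
... | no  x≢y | yes y≡x = contradiction (sym y≡x) x≢y
... | no  _   | no  _   = refl

𝟙-× : {A B : Set} (a : Dec A) (b : Dec B) → 𝟙 (a ×-dec b) ≡ 𝟙 a * 𝟙 b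
𝟙-× (yes _) (yes _) = refl
𝟙-× (yes _) (no _)  = refl
𝟙-× (no _)  _       = refl

𝟙-⊎ : {A B : Set} (a : Dec A) (b : Dec B) → ¬ (A × B) → 𝟙 (a ⊎-dec b) ≡ 𝟙 a + 𝟙 b
𝟙-⊎ (yes a) (yes b) ¬ab = contradiction (a , b) ¬ab
𝟙-⊎ (yes _) (no _)  _   = refl
𝟙-⊎ (no _)  (yes _) _   = refl
𝟙-⊎ (no _)  (no _)  _   = refl

sumFin≡sum : {n : ℕ} (f : Fin n → ℤ) → sumFin f ≡ sum f
sumFin≡sum {zero}  f = refl
sumFin≡sum {suc n} f = cong (f zero +_) (sumFin≡sum (λ i → f (suc i)))

sumFin-cong : {n : ℕ} {f g : Fin n → ℤ} → (∀ i → f i ≡ g i) → sumFin f ≡ sumFin g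
sumFin-cong {zero}  f≗g = refl
sumFin-cong {suc n} f≗g = cong₂ _+_ (f≗g zero) (sumFin-cong (λ i → f≗g (suc i)))

sum-zero : {n : ℕ} (f : Fin n → ℤ) → (∀ i → f i ≡ 0ℤ) → sum f ≡ 0ℤ
sum-zero {n} f f≗0 = trans (sum-cong-≗ f≗0) (sum-replicate-zero n)

sum-δ : {n : ℕ} (f : Fin n → ℤ) (c : Fin n) → sum (λ i → f i * 𝟙 (c ≟ i)) ≡ f c
sum-δ {suc n} f zero = begin
  f zero * 1ℤ + sum (λ i → f (suc i) * 0ℤ)
    ≡⟨ cong₂ _+_ (ℤ.*-identityʳ (f zero)) (sum-zero _ (λ i → ℤ.*-zeroʳ (f (suc i)))) ⟩
  f zero + 0ℤ
    ≡⟨ ℤ.+-identityʳ (f zero) ⟩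
  f zero ∎
  where open ≡-Reasoning
sum-δ {suc n} f (suc c) = begin
  f zero * 0ℤ + sum (λ i → f (suc i) * 𝟙 (c ≟ i))
    ≡⟨ cong₂ _+_ (ℤ.*-zeroʳ (f zero)) (sum-δ (λ i → f (suc i)) c) ⟩
  0ℤ + f (suc c)
    ≡⟨ ℤ.+-identityˡ (f (suc c)) ⟩
  f (suc c) ∎
  where open ≡-Reasoning

sum-δ′ : {n : ℕ} (f : Fin n → ℤ) (c : Fin n) → sum (λ i → f i * 𝟙 (i ≟ c)) ≡ f c
sum-δ′ f c = trans (sum-cong-≗ (λ i → cong (f i *_) (𝟙-comm i c))) (sum-δ f c)

sum-nonneg : {n : ℕ} (f : Fin n → ℤ) → (∀ i → 0ℤ ≤ f i) → 0ℤ ≤ sum f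
sum-nonneg {zero}  f f≥0 = ℤ.≤-refl
sum-nonneg {suc n} f f≥0 = ℤ.+-mono-≤ (f≥0 zero) (sum-nonneg (λ i → f (suc i)) (λ i → f≥0 (suc i)))

sum-pos : {n : ℕ} (f : Fin n → ℤ) → (∀ i → 0ℤ ≤ f i) → (c : Fin n) → 0ℤ < f c → 0ℤ < sum f
sum-pos {suc n} f f≥0 zero    fc>0 =
  ℤ.+-mono-<-≤ fc>0 (sum-nonneg (λ i → f (suc i)) (λ i → f≥0 (suc i)))
sum-pos {suc n} f f≥0 (suc c) fc>0 =
  ℤ.+-mono-≤-< (f≥0 zero) (sum-pos (λ i → f (suc i)) (λ i → f≥0 (suc i)) c fc>0)

Array : ℕ → Set
Array n = Fin n → Fin n → ℤ

∑² : {n : ℕ} → Array n → ℤ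
∑² X = sum (λ p → sum (λ q → X p q))

∑²-cong : {n : ℕ} {X Y : Array n} → (∀ p q → X p q ≡ Y p q) → ∑² X ≡ ∑² Y
∑²-cong X≗Y = sum-cong-≗ (λ p → sum-cong-≗ (X≗Y p))

∑²-zero : {n : ℕ} {X : Array n} → (∀ p q → X p q ≡ 0ℤ) → ∑² X ≡ 0ℤ
∑²-zero X≡0 = sum-zero _ (λ p → sum-zero _ (X≡0 p))

∑²-+ : {n : ℕ} (X Y : Array n) → ∑² (λ p q → X p q + Y p q) ≡ ∑² X + ∑² Y
∑²-+ X Y = trans (sum-cong-≗ (λ p → ∑-distrib-+ (X p) (Y p))) (∑-distrib-+ (λ p → sum (X p)) (λ p → sum (Y p)))

∑²-* : {n : ℕ} (c : ℤ) (X : Array n) → ∑² (λ p q → c * X p q) ≡ c * ∑² X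
∑²-* c X = begin
  sum (λ p → sum (λ q → c * X p q)) ≡⟨ sum-cong-≗ (λ p → *-distribˡ-sum c (X p)) ⟨
  sum (λ p → c * sum (X p))         ≡⟨ *-distribˡ-sum c (λ p → sum (X p)) ⟨
  c * ∑² X                          ∎
  where open ≡-Reasoning

∑²-sum : {m n : ℕ} (X : Fin m → Array n) → ∑² (λ p q → sum (λ w → X w p q)) ≡ sum (λ w → ∑² (X w))
∑²-sum X = trans (sum-cong-≗ (λ p → ∑-comm (λ q w → X w p q))) (∑-comm (λ p w → sum (X w p)))

∑²-pos : {n : ℕ} (X : Array n) → (∀ p q → 0ℤ ≤ X p q) → ∀ s t → 0ℤ < X s t → 0ℤ < ∑² X
∑²-pos X X≥0 s t Xst>0 = sum-pos _ (λ p → sum-nonneg (X p) (X≥0 p)) s (sum-pos (X s) (X≥0 s) t Xst>0)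

-- Row combinations

extend : {n : ℕ} → (Edge n → ℤ) → Array n
extend f u v with u <? v
... | yes u<v = f ((u , v) , u<v)
... | no  _   = 0ℤ

extend-edge : {n : ℕ} (f : Edge n → ℤ) {u v : Fin n} (u<v : u F.< v) → extend f u v ≡ f ((u , v) , u<v)
extend-edge f {u} {v} u<v with u <? v
... | yes u<v′ = cong (λ l → f ((u , v) , l)) (F.<-irrelevant u<v′ u<v)
... | no  u≮v  = contradiction u<v u≮v

extend-upper : {n : ℕ} (f : Edge n → ℤ) {u v : Fin n} → extend f u v ≢ 0ℤ → u F.< v
extend-upper f {u} {v} fuv≢0 with u <? v
... | yes u<v = u<v
... | no  _   = contradiction refl fuv≢0

sumFin²≡∑² : {n : ℕ} (X : Array n) → sumFin (λ p → sumFin (X p)) ≡ ∑² X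
sumFin²≡∑² X = trans (sumFin≡sum (λ p → sumFin (X p))) (sum-cong-≗ (λ p → sumFin≡sum (X p)))

-- The left-hand side is the summand of `edgeSum`, a where-bound helper of Defs that cannot be
-- named here. It is inferred from the use in `edgeSumWhere≡∑²`, which therefore has to be
-- checked before the clauses below.
summand : {n : ℕ} (P : Edge n → Set) (P? : ∀ e → Dec (P e)) (f : Edge n → ℤ) (u v : Fin n) →
          _ ≡ extend (λ e → 𝟙 (P? e) * f e) u v

edgeSumWhere≡∑² : {n : ℕ} (P : Edge n → Set) (P? : ∀ e → Dec (P e)) (f : Edge n → ℤ) →
                  edgeSumWhere P P? f ≡ ∑² (extend (λ e → 𝟙 (P? e) * f e))
edgeSumWhere≡∑² P P? f =
  trans (sumFin-cong (λ u → sumFin-cong (summand P P? f u))) (sumFin²≡∑² (extend (λ e → 𝟙 (P? e) * f e)))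

summand P P? f u v with u <? v
... | no  _   = refl
... | yes u<v with P? ((u , v) , u<v)
...   | yes _ = sym (ℤ.*-identityˡ _)
...   | no  _ = refl

vertexRow : {n : ℕ} → Fin n → Array n
vertexRow w p q = 𝟙 (w ≟ p) + 𝟙 (w ≟ q)

colourRow : {n k : ℕ} → (Fin n → Fin k) → Fin k → Fin k → Array n
colourRow z i j p q = 𝟙 (z p ≟ i) * 𝟙 (z q ≟ j)

weight : {n k : ℕ} → (Fin n → Fin k) → (Fin n → ℤ) → (Fin k → Fin k → ℤ) → Array n
weight z α β p q = α p + α q + β (z p) (z q)

Balanced : {n k : ℕ} → (Fin n → Fin k) → Array n → Set
Balanced z Γ = ∀ α β → ∑² (λ p q → weight z α β p q * Γ p q) ≡ 0ℤ

module _ {n k : ℕ} (z : Fin n → Fin k) where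

  weight≡rows : ∀ α β p q → weight z α β p q ≡
    sum (λ w → α w * vertexRow w p q) + sum (λ i → sum (λ j → β i j * colourRow z i j p q))
  weight≡rows α β p q = sym (cong₂ _+_ vertex colour)
    where
    open ≡-Reasoning
    vertex : sum (λ w → α w * vertexRow w p q) ≡ α p + α q
    vertex = begin
      sum (λ w → α w * (𝟙 (w ≟ p) + 𝟙 (w ≟ q)))
        ≡⟨ sum-cong-≗ (λ w → ℤ.*-distribˡ-+ (α w) _ _) ⟩
      sum (λ w → α w * 𝟙 (w ≟ p) + α w * 𝟙 (w ≟ q))
        ≡⟨ ∑-distrib-+ (λ w → α w * 𝟙 (w ≟ p)) _ ⟩
      sum (λ w → α w * 𝟙 (w ≟ p)) + sum (λ w → α w * 𝟙 (w ≟ q))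
        ≡⟨ cong₂ _+_ (sum-δ′ α p) (sum-δ′ α q) ⟩
      α p + α q ∎
    colour : sum (λ i → sum (λ j → β i j * colourRow z i j p q)) ≡ β (z p) (z q)
    colour = begin
      sum (λ i → sum (λ j → β i j * (𝟙 (z p ≟ i) * 𝟙 (z q ≟ j))))
        ≡⟨ sum-cong-≗ (λ i → sum-cong-≗ (λ j → regroup (β i j) _ _)) ⟩
      sum (λ i → sum (λ j → β i j * 𝟙 (z q ≟ j) * 𝟙 (z p ≟ i)))
        ≡⟨ sum-cong-≗ (λ i → *-distribʳ-sum (𝟙 (z p ≟ i)) (λ j → β i j * 𝟙 (z q ≟ j))) ⟨
      sum (λ i → sum (λ j → β i j * 𝟙 (z q ≟ j)) * 𝟙 (z p ≟ i))
        ≡⟨ sum-δ (λ i → sum (λ j → β i j * 𝟙 (z q ≟ j))) (z p) ⟩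
      sum (λ j → β (z p) j * 𝟙 (z q ≟ j))
        ≡⟨ sum-δ (β (z p)) (z q) ⟩
      β (z p) (z q) ∎
      where
      regroup : ∀ x a b → x * (a * b) ≡ x * b * a
      regroup x a b = trans (cong (x *_) (ℤ.*-comm a b)) (sym (ℤ.*-assoc x b a))

  weighted≡rows : (Γ : Array n) → ∀ α β p q → weight z α β p q * Γ p q ≡
    sum (λ w → α w * (vertexRow w p q * Γ p q)) + sum (λ i → sum (λ j → β i j * (colourRow z i j p q * Γ p q)))
  weighted≡rows Γ α β p q = begin
    weight z α β p q * x
      ≡⟨ cong (_* x) (weight≡rows α β p q) ⟩
    (sum (λ w → α w * vertexRow w p q) + sum (λ i → sum (λ j → β i j * colourRow z i j p q))) * x
      ≡⟨ ℤ.*-distribʳ-+ x (sum (λ w → α w * vertexRow w p q)) _ ⟩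
    sum (λ w → α w * vertexRow w p q) * x + sum (λ i → sum (λ j → β i j * colourRow z i j p q)) * x
      ≡⟨ cong₂ _+_ (sum-*-assoc α (λ w → vertexRow w p q))
                   (trans (*-distribʳ-sum x (λ i → sum (λ j → β i j * colourRow z i j p q)))
                          (sum-cong-≗ (λ i → sum-*-assoc (β i) (λ j → colourRow z i j p q)))) ⟩
    sum (λ w → α w * (vertexRow w p q * x)) + sum (λ i → sum (λ j → β i j * (colourRow z i j p q * x))) ∎
    where
    open ≡-Reasoning
    x : ℤ
    x = Γ p q
    sum-*-assoc : {m : ℕ} (c r : Fin m → ℤ) → sum (λ w → c w * r w) * x ≡ sum (λ w → c w * (r w * x))
    sum-*-assoc c r = trans (*-distribʳ-sum x (λ w → c w * r w)) (sum-cong-≗ (λ w → ℤ.*-assoc (c w) (r w) x))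

  rows⇒balanced : (Γ : Array n) →
    (∀ w → ∑² (λ p q → vertexRow w p q * Γ p q) ≡ 0ℤ) →
    (∀ i j → ∑² (λ p q → colourRow z i j p q * Γ p q) ≡ 0ℤ) → Balanced z Γ
  rows⇒balanced Γ vertex≡0 colour≡0 α β = begin
    ∑² (λ p q → weight z α β p q * Γ p q) ≡⟨ ∑²-cong (weighted≡rows Γ α β) ⟩
    ∑² (λ p q → V p q + C p q)            ≡⟨ ∑²-+ V C ⟩
    ∑² V + ∑² C                           ≡⟨ cong₂ _+_ (combination≡0 α vertex≡0)
                                                       (∑²-sum≡0 (λ i → combination≡0 (β i) (colour≡0 i))) ⟩
    0ℤ + 0ℤ                               ∎
    where
    open ≡-Reasoning
    V C : Array n
    V p q = sum (λ w → α w * (vertexRow w p q * Γ p q))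
    C p q = sum (λ i → sum (λ j → β i j * (colourRow z i j p q * Γ p q)))
    ∑²-sum≡0 : {m : ℕ} {X : Fin m → Array n} → (∀ w → ∑² (X w) ≡ 0ℤ) →
               ∑² (λ p q → sum (λ w → X w p q)) ≡ 0ℤ
    ∑²-sum≡0 {X = X} X≡0 = trans (∑²-sum X) (sum-zero _ X≡0)
    combination≡0 : {m : ℕ} (c : Fin m → ℤ) {X : Fin m → Array n} → (∀ w → ∑² (X w) ≡ 0ℤ) →
                    ∑² (λ p q → sum (λ w → c w * X w p q)) ≡ 0ℤ
    combination≡0 c {X} X≡0 =
      ∑²-sum≡0 (λ w → trans (∑²-* (c w) (X w)) (trans (cong (c w *_) (X≡0 w)) (ℤ.*-zeroʳ (c w))))

minF-≤ : {k : ℕ} {a b : Fin k} → a F.≤ b → minF a b ≡ a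
minF-≤ {a = a} {b} a≤b with a ≤? b
... | yes _   = refl
... | no  a≰b = contradiction a≤b a≰b

maxF-≤ : {k : ℕ} {a b : Fin k} → a F.≤ b → maxF a b ≡ b
maxF-≤ {a = a} {b} a≤b with a ≤? b
... | yes _   = refl
... | no  a≰b = contradiction a≤b a≰b

module _ {n k : ℕ} {z : Fin n → Fin k} (mono : NonDecreasing z) {γ : Edge n → ℤ} (γ∈ker : InKernel z γ) where

  vertexRow-annihilates : ∀ w → ∑² (λ p q → vertexRow w p q * extend γ p q) ≡ 0ℤ
  vertexRow-annihilates w = begin
    ∑² (λ p q → vertexRow w p q * extend γ p q)      ≡⟨ ∑²-cong restrict ⟨
    ∑² (extend (λ e → 𝟙 (incident? w e) * γ e))      ≡⟨ edgeSumWhere≡∑² (incident w) (incident? w) γ ⟨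
    edgeSumWhere (incident w) (incident? w) γ        ≡⟨ proj₁ γ∈ker w ⟩
    0ℤ                                               ∎
    where
    open ≡-Reasoning
    restrict : ∀ p q → extend (λ e → 𝟙 (incident? w e) * γ e) p q ≡ vertexRow w p q * extend γ p q
    restrict p q with p <? q
    ... | yes p<q = cong (_* γ _) (𝟙-⊎ (w ≟ p) (w ≟ q) (λ (w≡p , w≡q) → F.<⇒≢ p<q (trans (sym w≡p) w≡q)))
    ... | no  _   = sym (ℤ.*-zeroʳ (vertexRow w p q))

  colourRow-annihilates : ∀ i j → ∑² (λ p q → colourRow z i j p q * extend γ p q) ≡ 0ℤ
  colourRow-annihilates i j with i ≤? j
  ... | yes i≤j = begin
    ∑² (λ p q → colourRow z i j p q * extend γ p q)  ≡⟨ ∑²-cong restrict ⟨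
    ∑² (extend (λ e → 𝟙 (inRow? z i j e) * γ e))     ≡⟨ edgeSumWhere≡∑² (inRow z i j) (inRow? z i j) γ ⟨
    edgeSumWhere (inRow z i j) (inRow? z i j) γ      ≡⟨ proj₂ γ∈ker i j i≤j ⟩
    0ℤ                                               ∎
    where
    open ≡-Reasoning
    restrict : ∀ p q → extend (λ e → 𝟙 (inRow? z i j e) * γ e) p q ≡ colourRow z i j p q * extend γ p q
    restrict p q with p <? q
    ... | no  _   = sym (ℤ.*-zeroʳ (colourRow z i j p q))
    ... | yes p<q rewrite minF-≤ (mono p q (ℕ.<⇒≤ p<q)) | maxF-≤ (mono p q (ℕ.<⇒≤ p<q)) =
      cong (_* γ _) (𝟙-× (z p ≟ i) (z q ≟ j))
  ... | no i≰j = ∑²-zero vanish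
    where
    vanish : ∀ p q → colourRow z i j p q * extend γ p q ≡ 0ℤ
    vanish p q with z p ≟ i | z q ≟ j
    ... | no  _    | _        = refl
    ... | yes _    | no  _    = refl
    ... | yes refl | yes refl with p <? q
    ...   | yes p<q = contradiction (mono p q (ℕ.<⇒≤ p<q)) i≰j
    ...   | no  _   = refl

  inKernel⇒balanced : Balanced z (extend γ)
  inKernel⇒balanced = rows⇒balanced z (extend γ) vertexRow-annihilates colourRow-annihilates

-- Chords of the convex n-gon

_⇔?_ : {A B : Set} → Dec A → Dec B → Dec (A ⇔ B)
a? ⇔? b? = map′ (λ (f , g) → mk⇔ f g) (λ e → Equivalence.to e , Equivalence.from e)
                ((a? →-dec b?) ×-dec (b? →-dec a?))

module _ {n : ℕ} where

  between? : (a x b : Fin n) → Dec (between a x b)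
  between? a x b = ((a <? x) ×-dec (x <? b)) ⊎-dec ((b <? x) ×-dec (x <? a))

  nonIntersecting? : (u v u′ v′ : Fin n) → Dec (NonIntersecting u v u′ v′)
  nonIntersecting? u v u′ v′ =
    ¬? (u ≟ u′) ×-dec ¬? (u ≟ v′) ×-dec ¬? (v ≟ u′) ×-dec ¬? (v ≟ v′) ×-dec
    (between? u u′ v ⇔? between? u v′ v)

  between-sym : {a x b : Fin n} → between a x b → between b x a
  between-sym (inj₁ a<x<b) = inj₂ a<x<b
  between-sym (inj₂ b<x<a) = inj₁ b<x<a

  between⇒≢ : {a x b : Fin n} → between a x b → a ≢ x × b ≢ x
  between⇒≢ (inj₁ (a<x , x<b)) = F.<⇒≢ a<x , ≢-sym (F.<⇒≢ x<b)
  between⇒≢ (inj₂ (b<x , x<a)) = ≢-sym (F.<⇒≢ x<a) , F.<⇒≢ b<x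

  nonIntersecting-nested : {u v u′ v′ : Fin n} → between u u′ v → between u v′ v → NonIntersecting u v u′ v′
  nonIntersecting-nested u′∈uv v′∈uv =
    let (u≢u′ , v≢u′) = between⇒≢ u′∈uv
        (u≢v′ , v≢v′) = between⇒≢ v′∈uv
    in u≢u′ , u≢v′ , v≢u′ , v≢v′ , mk⇔ (λ _ → v′∈uv) (λ _ → u′∈uv)

  Outside : Fin n → Fin n → Fin n → Set
  Outside u v x = x F.< u ⊎ v F.< x

  outside⇒≢ : {u v x : Fin n} → u F.< v → Outside u v x → u ≢ x × v ≢ x
  outside⇒≢ u<v (inj₁ x<u) = ≢-sym (F.<⇒≢ x<u) , ≢-sym (F.<⇒≢ (F.<-trans x<u u<v))
  outside⇒≢ u<v (inj₂ v<x) = F.<⇒≢ (F.<-trans u<v v<x) , F.<⇒≢ v<x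

  outside⇒¬between : {u v x : Fin n} → u F.< v → Outside u v x → ¬ between u x v
  outside⇒¬between u<v (inj₁ x<u) (inj₁ (u<x , _)) = F.<-asym x<u u<x
  outside⇒¬between u<v (inj₂ v<x) (inj₁ (_ , x<v)) = F.<-asym v<x x<v
  outside⇒¬between u<v _          (inj₂ (v<x , x<u)) = F.<-asym u<v (F.<-trans v<x x<u)

  nonIntersecting-outside : {u v u′ v′ : Fin n} → u F.< v → Outside u v u′ → Outside u v v′ →
                            NonIntersecting u v u′ v′
  nonIntersecting-outside u<v u′∉uv v′∉uv =
    let (u≢u′ , v≢u′) = outside⇒≢ u<v u′∉uv
        (u≢v′ , v≢v′) = outside⇒≢ u<v v′∉uv
    in u≢u′ , u≢v′ , v≢u′ , v≢v′ ,
       mk⇔ (λ b → contradiction b (outside⇒¬between u<v u′∉uv))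
           (λ b → contradiction b (outside⇒¬between u<v v′∉uv))

  nonIntersecting-swapˡ : {u v u′ v′ : Fin n} → NonIntersecting u v u′ v′ → NonIntersecting v u u′ v′
  nonIntersecting-swapˡ (u≢u′ , u≢v′ , v≢u′ , v≢v′ , same-side) =
    v≢u′ , v≢v′ , u≢u′ , u≢v′ ,
    mk⇔ (λ b → between-sym (Equivalence.to same-side (between-sym b)))
        (λ b → between-sym (Equivalence.from same-side (between-sym b)))

  nonIntersecting-swapʳ : {u v u′ v′ : Fin n} → NonIntersecting u v u′ v′ → NonIntersecting u v v′ u′
  nonIntersecting-swapʳ (u≢u′ , u≢v′ , v≢u′ , v≢v′ , same-side) =
    u≢v′ , u≢u′ , v≢v′ , v≢u′ , mk⇔ (Equivalence.from same-side) (Equivalence.to same-side)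

-- Witnesses and counterexamples

data SameSign (x y : ℤ) : Set where
  both-positive : 0ℤ < x → 0ℤ < y → SameSign x y
  both-negative : x < 0ℤ → y < 0ℤ → SameSign x y

sameSign? : (x y : ℤ) → Dec (SameSign x y)
sameSign? x y =
  map′ [ (λ (x>0 , y>0) → both-positive x>0 y>0) , (λ (x<0 , y<0) → both-negative x<0 y<0) ]′
       (λ { (both-positive x>0 y>0) → inj₁ (x>0 , y>0) ; (both-negative x<0 y<0) → inj₂ (x<0 , y<0) })
       (((0ℤ ℤ.<? x) ×-dec (0ℤ ℤ.<? y)) ⊎-dec ((x ℤ.<? 0ℤ) ×-dec (y ℤ.<? 0ℤ)))

sameSign-neg : {x y : ℤ} → SameSign (- x) (- y) → SameSign x y
sameSign-neg (both-positive -x>0 -y>0) = both-negative (ℤ.neg-cancel-< -x>0) (ℤ.neg-cancel-< -y>0)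
sameSign-neg (both-negative -x<0 -y<0) = both-positive (ℤ.neg-cancel-< -x<0) (ℤ.neg-cancel-< -y<0)

>0⇒≢0 : {x : ℤ} → 0ℤ < x → x ≢ 0ℤ
>0⇒≢0 x>0 = ≢-sym (ℤ.<⇒≢ x>0)

<0⇒≢0 : {x : ℤ} → x < 0ℤ → x ≢ 0ℤ
<0⇒≢0 = ℤ.<⇒≢

sameSign⇒≢0 : {x y : ℤ} → SameSign x y → x ≢ 0ℤ × y ≢ 0ℤ
sameSign⇒≢0 (both-positive x>0 y>0) = >0⇒≢0 x>0 , >0⇒≢0 y>0
sameSign⇒≢0 (both-negative x<0 y<0) = <0⇒≢0 x<0 , <0⇒≢0 y<0

neg-≢0 : {x : ℤ} → x ≢ 0ℤ → - x ≢ 0ℤ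
neg-≢0 {x} x≢0 -x≡0 = x≢0 (trans (sym (ℤ.neg-involutive x)) (cong -_ -x≡0))

negated : {n : ℕ} → Array n → Array n
negated Γ p q = - Γ p q

negated-support : {n : ℕ} {Γ : Array n} {p q : Fin n} → negated Γ p q ≢ 0ℤ → Γ p q ≢ 0ℤ
negated-support -Γpq≢0 Γpq≡0 = -Γpq≢0 (cong -_ Γpq≡0)

module _ {n k : ℕ} where

  data ColourShared (z : Fin n → Fin k) (p q p′ q′ : Fin n) : Set where
    src-src : z p ≡ z p′ → ColourShared z p q p′ q′
    src-tgt : z p ≡ z q′ → ColourShared z p q p′ q′
    tgt-src : z q ≡ z p′ → ColourShared z p q p′ q′
    tgt-tgt : z q ≡ z q′ → ColourShared z p q p′ q′

  colourShared? : (z : Fin n → Fin k) (p q p′ q′ : Fin n) → Dec (ColourShared z p q p′ q′)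
  colourShared? z p q p′ q′ = map′ [ src-src , [ src-tgt , [ tgt-src , tgt-tgt ]′ ]′ ]′
    (λ { (src-src e) → inj₁ e ; (src-tgt e) → inj₂ (inj₁ e)
       ; (tgt-src e) → inj₂ (inj₂ (inj₁ e)) ; (tgt-tgt e) → inj₂ (inj₂ (inj₂ e)) })
    ((z p ≟ z p′) ⊎-dec (z p ≟ z q′) ⊎-dec (z q ≟ z p′) ⊎-dec (z q ≟ z q′))

  Witness : (Fin n → Fin k) → Array n → (p q p′ q′ : Fin n) → Set
  Witness z Γ p q p′ q′ = NonIntersecting p q p′ q′ × ColourShared z p q p′ q′ × SameSign (Γ p q) (Γ p′ q′)

  witness? : (z : Fin n → Fin k) (Γ : Array n) (p q p′ q′ : Fin n) → Dec (Witness z Γ p q p′ q′)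
  witness? z Γ p q p′ q′ =
    nonIntersecting? p q p′ q′ ×-dec colourShared? z p q p′ q′ ×-dec sameSign? (Γ p q) (Γ p′ q′)

  record Counterexample (z : Fin n → Fin k) (Γ : Array n) : Set where
    field
      upper        : ∀ {p q} → Γ p q ≢ 0ℤ → p F.< q
      balanced     : Balanced z Γ
      witness-free : ∀ {p q p′ q′} → ¬ Witness z Γ p q p′ q′
      support      : ∃₂ λ s t → Γ s t ≢ 0ℤ

  weight-negated : (z : Fin n → Fin k) (Γ : Array n) (α : Fin n → ℤ) (β : Fin k → Fin k → ℤ) (p q : Fin n) →
    weight z α β p q * negated Γ p q ≡ weight z (λ w → - α w) (λ i j → - β i j) p q * Γ p q
  weight-negated z Γ α β p q = begin
    w * - Γ p q
      ≡⟨ ℤ.neg-distribʳ-* w (Γ p q) ⟨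
    - (w * Γ p q)
      ≡⟨ ℤ.neg-distribˡ-* w (Γ p q) ⟩
    - (α p + α q + β (z p) (z q)) * Γ p q
      ≡⟨ cong (_* Γ p q) (trans (ℤ.neg-distrib-+ (α p + α q) (β (z p) (z q)))
                                (cong (_+ - β (z p) (z q)) (ℤ.neg-distrib-+ (α p) (α q)))) ⟩
    (- α p + - α q + - β (z p) (z q)) * Γ p q ∎
    where
    open ≡-Reasoning
    w : ℤ
    w = weight z α β p q

  negate : {z : Fin n → Fin k} {Γ : Array n} → Counterexample z Γ → Counterexample z (negated Γ)
  negate {z} {Γ} C = record
    { upper        = λ -Γpq≢0 → upper (negated-support {Γ = Γ} -Γpq≢0)
    ; balanced     = λ α β → trans (∑²-cong (weight-negated z Γ α β)) (balanced (λ w → - α w) (λ i j → - β i j))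
    ; witness-free = λ (disjoint , shared , same-sign) → witness-free (disjoint , shared , sameSign-neg same-sign)
    ; support      = let (s , t , Γst≢0) = support in s , t , neg-≢0 Γst≢0
    }
    where open Counterexample C

ColourIncreasing : {n k : ℕ} → (Fin n → Fin k) → Array n → Set
ColourIncreasing z Γ = ∀ {p q} → Γ p q ≢ 0ℤ → z p F.< z q

negated-increasing : {n k : ℕ} {z : Fin n → Fin k} {Γ : Array n} →
                     ColourIncreasing z Γ → ColourIncreasing z (negated Γ)
negated-increasing {Γ = Γ} increasing {p} {q} -Γpq≢0 = increasing {p} {q} (negated-support {Γ = Γ} -Γpq≢0)

least : {n : ℕ} {P : Fin n → Set} → (∀ x → Dec (P x)) → ∃ P → ∃ λ x → P x × (∀ {y} → P y → x F.≤ y)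
least {suc n} P? (x , Px) with P? zero
... | yes P0 = zero , P0 , λ _ → z≤n
least {suc n} P? (zero  , P0) | no ¬P0 = contradiction P0 ¬P0
least {suc n} P? (suc x , Px) | no ¬P0 =
  let (m , Pm , m-least) = least (λ i → P? (suc i)) (x , Px)
  in suc m , Pm , λ { {zero} P0 → contradiction P0 ¬P0 ; {suc y} Py → s≤s (m-least Py) }

greatest : {n : ℕ} {P : Fin n → Set} → (∀ x → Dec (P x)) → ∃ P → ∃ λ x → P x × (∀ {y} → P y → y F.≤ x)
greatest {suc n} P? (x , Px) with any? (λ i → P? (suc i))
... | yes later =
  let (m , Pm , m-greatest) = greatest (λ i → P? (suc i)) later
  in suc m , Pm , λ { {zero} _ → z≤n ; {suc y} Py → s≤s (m-greatest Py) }
greatest {suc n} P? (zero  , P0) | no ¬later =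
  zero , P0 , λ { {zero} _ → z≤n ; {suc y} Py → contradiction (y , Py) ¬later }
greatest {suc n} P? (suc x , Px) | no ¬later = contradiction (x , Px) ¬later

nonDecreasing-reflects-< : {n k : ℕ} {z : Fin n → Fin k} → NonDecreasing z → ∀ {x y} → z x F.< z y → x F.< y
nonDecreasing-reflects-< mono {x} {y} zx<zy = ℕ.≰⇒> (λ y≤x → ℕ.<⇒≱ zx<zy (mono y x y≤x))

sole-entry⇒nonneg : {n : ℕ} {Δ : Array n} {R : Fin n → Fin n → Set} {s t : Fin n} →
  (∀ {p q} → R p q → Δ p q ≢ 0ℤ → p ≡ s × q ≡ t) → 0ℤ < Δ s t → ∀ {p q} → R p q → 0ℤ ≤ Δ p q
sole-entry⇒nonneg {Δ = Δ} sole Δst>0 {p} {q} Rpq with Δ p q ℤ.≟ 0ℤ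
... | yes Δpq≡0 = ℤ.≤-reflexive (sym Δpq≡0)
... | no  Δpq≢0 with sole Rpq Δpq≢0
...   | refl , refl = ℤ.<⇒≤ Δst>0

1*-nonneg : {x : ℤ} → 0ℤ ≤ x → 0ℤ ≤ 1ℤ * x
1*-nonneg {x} = subst (0ℤ ≤_) (sym (ℤ.*-identityˡ x))

1*-pos : {x : ℤ} → 0ℤ < x → 0ℤ < 1ℤ * x
1*-pos {x} = subst (0ℤ <_) (sym (ℤ.*-identityˡ x))

-1*-nonneg : {x : ℤ} → x ≤ 0ℤ → 0ℤ ≤ -1ℤ * x
-1*-nonneg {x} x≤0 = subst (0ℤ ≤_) (sym (ℤ.-1*i≡-i x)) (ℤ.neg-mono-≤ x≤0)

*0-nonneg : (w : ℤ) {x : ℤ} → x ≡ 0ℤ → 0ℤ ≤ w * x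
*0-nonneg w refl = ℤ.≤-reflexive (sym (ℤ.*-zeroʳ w))

-- Certificates

module Certificates {n k : ℕ} {z : Fin n → Fin k} (mono : NonDecreasing z) {Γ : Array n} (C : Counterexample z Γ) where

  open Counterexample C

  no-certificate : ∀ α β → (∀ p q → 0ℤ ≤ weight z α β p q * Γ p q) →
                   ∀ s t → ¬ (0ℤ < weight z α β s t * Γ s t)
  no-certificate α β nonneg s t positive = ℤ.<-irrefl (sym (balanced α β)) (∑²-pos _ nonneg s t positive)

  positive-at-unit-weight : ∀ α β {s t} → weight z α β s t ≡ 1ℤ → 0ℤ < Γ s t → 0ℤ < weight z α β s t * Γ s t
  positive-at-unit-weight α β {s} {t} wst≡1 Γst>0 = subst (λ w → 0ℤ < w * Γ s t) (sym wst≡1) (1*-pos Γst>0)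

  negative-entry : ∀ α β → (∀ {p q} → Γ p q ≢ 0ℤ → weight z α β p q ≡ 0ℤ ⊎ weight z α β p q ≡ 1ℤ) →
                   ∀ {s t} → weight z α β s t ≡ 1ℤ → 0ℤ < Γ s t →
                   ∃₂ λ p q → weight z α β p q ≡ 1ℤ × Γ p q < 0ℤ
  negative-entry α β 0or1 {s} {t} wst≡1 Γst>0
    with any? (λ p → any? (λ q → (weight z α β p q ℤ.≟ 1ℤ) ×-dec (Γ p q ℤ.<? 0ℤ)))
  ... | yes found = found
  ... | no  none  = contradiction (positive-at-unit-weight α β wst≡1 Γst>0) (no-certificate α β products-nonneg s t)
    where
    products-nonneg : ∀ p q → 0ℤ ≤ weight z α β p q * Γ p q
    products-nonneg p q with Γ p q ℤ.≟ 0ℤ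
    ... | yes Γpq≡0 = *0-nonneg (weight z α β p q) Γpq≡0
    ... | no  Γpq≢0 with 0or1 Γpq≢0
    ...   | inj₁ w≡0 rewrite w≡0 = ℤ.≤-refl
    ...   | inj₂ w≡1 rewrite w≡1 = 1*-nonneg (ℤ.≮⇒≥ (λ Γpq<0 → none (p , q , w≡1 , Γpq<0)))

  -- The certificate is the colour row (K, K) minus the vertex rows of colour K outside [s, t].
  interval-certificate : ∀ {s t} → z s ≡ z t → 0ℤ < Γ s t →
                         (∀ {p q} → s F.≤ p → q F.≤ t → 0ℤ ≤ Γ p q) → ⊥
  interval-certificate {s} {t} zs≡zt Γst>0 nonneg-inside =
    no-certificate α β products-nonneg s t (positive-at-unit-weight α β weight-st Γst>0)
    where
    s<t : s F.< t
    s<t = upper (>0⇒≢0 Γst>0)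
    K : Fin k
    K = z s
    Inside : Fin n → Set
    Inside w = s F.≤ w × w F.≤ t
    inside? : ∀ w → Dec (Inside w)
    inside? w = (s ≤? w) ×-dec (w ≤? t)
    α : Fin n → ℤ
    α w = - 𝟙 ((z w ≟ K) ×-dec ¬? (inside? w))
    β : Fin k → Fin k → ℤ
    β i j = 𝟙 ((i ≟ K) ×-dec (j ≟ K))

    inside⇒K : ∀ {w} → Inside w → z w ≡ K
    inside⇒K (s≤w , w≤t) = F.≤-antisym (subst (z _ F.≤_) (sym zs≡zt) (mono _ _ w≤t)) (mono _ _ s≤w)

    outside : ∀ {w} → ¬ Inside w → Outside s t w
    outside {w} w∉ with s ≤? w
    ... | yes s≤w = inj₂ (ℕ.≰⇒> (λ w≤t → w∉ (s≤w , w≤t)))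
    ... | no  s≰w = inj₁ (ℕ.≰⇒> s≰w)

    weight-st : weight z α β s t ≡ 1ℤ
    weight-st rewrite dec-false ((z s ≟ K) ×-dec ¬? (inside? s)) (λ (_ , s∉) → s∉ (F.≤-refl , ℕ.<⇒≤ s<t))
                    | dec-false ((z t ≟ K) ×-dec ¬? (inside? t)) (λ (_ , t∉) → t∉ (ℕ.<⇒≤ s<t , F.≤-refl))
                    | dec-true ((z s ≟ K) ×-dec (z t ≟ K)) (refl , sym zs≡zt) = refl

    nonpos-outside : ∀ {p q} → ¬ Inside p → ¬ Inside q → ColourShared z s t p q → Γ p q ≤ 0ℤ
    nonpos-outside p∉ q∉ shared = ℤ.≮⇒≥ (λ Γpq>0 →
      witness-free (nonIntersecting-outside s<t (outside p∉) (outside q∉) , shared , both-positive Γst>0 Γpq>0))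

    -- Stated over the decisions themselves, because the `Fin` order tests reduce to boolean
    -- tests that `with` cannot abstract.
    products-nonneg : ∀ p q → 0ℤ ≤ weight z α β p q * Γ p q
    products-nonneg p q = by-cases (z p ≟ K) (z q ≟ K) (inside? p) (inside? q)
      where
      by-cases : (Kp : Dec (z p ≡ K)) (Kq : Dec (z q ≡ K)) (Ip : Dec (Inside p)) (Iq : Dec (Inside q)) →
                 0ℤ ≤ (- 𝟙 (Kp ×-dec ¬? Ip) + - 𝟙 (Kq ×-dec ¬? Iq) + 𝟙 (Kp ×-dec Kq)) * Γ p q
      by-cases (no  _)    (no  _)    _        _        = ℤ.≤-refl
      by-cases (yes _)    (no  _)    (yes _)  _        = ℤ.≤-refl
      by-cases (yes zp≡K) (no  zq≢K) (no  p∉) _        =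
        -1*-nonneg (nonpos-outside p∉ (zq≢K ∘ inside⇒K) (src-src (sym zp≡K)))
      by-cases (no  _)    (yes _)    _        (yes _)  = ℤ.≤-refl
      by-cases (no  zp≢K) (yes zq≡K) _        (no  q∉) =
        -1*-nonneg (nonpos-outside (zp≢K ∘ inside⇒K) q∉ (src-tgt (sym zq≡K)))
      by-cases (yes _)    (yes _)    (yes p∈) (yes q∈) = 1*-nonneg (nonneg-inside (proj₁ p∈) (proj₂ q∈))
      by-cases (yes _)    (yes _)    (yes _)  (no  _)  = ℤ.≤-refl
      by-cases (yes _)    (yes _)    (no  _)  (yes _)  = ℤ.≤-refl
      by-cases (yes zp≡K) (yes _)    (no  p∉) (no  q∉) = -1*-nonneg (nonpos-outside p∉ q∉ (src-src (sym zp≡K)))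

  -- The certificate is the sum of the vertex rows of colour J up to t minus the colour rows
  -- (J, j) with J < j.
  threshold-certificate : ColourIncreasing z Γ → ∀ {s t} → 0ℤ < Γ s t →
                          (∀ {p q} → z q ≡ z t → q F.≤ t → 0ℤ ≤ Γ p q) → ⊥
  threshold-certificate increasing {s} {t} Γst>0 nonneg-below =
    no-certificate α β products-nonneg s t (positive-at-unit-weight α β weight-st Γst>0)
    where
    s<t : s F.< t
    s<t = upper (>0⇒≢0 Γst>0)
    J : Fin k
    J = z t
    α : Fin n → ℤ
    α w = 𝟙 ((z w ≟ J) ×-dec (w ≤? t))
    β : Fin k → Fin k → ℤ
    β i j = - 𝟙 ((i ≟ J) ×-dec (J <? j))

    weight-st : weight z α β s t ≡ 1ℤ
    weight-st rewrite dec-false ((z s ≟ J) ×-dec (s ≤? t))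
                                (λ (zs≡J , _) → F.<⇒≢ (increasing (>0⇒≢0 Γst>0)) zs≡J)
                    | dec-true ((z t ≟ J) ×-dec (t ≤? t)) (refl , F.≤-refl)
                    | dec-false ((z s ≟ J) ×-dec (J <? J)) (λ (_ , J<J) → F.<-irrefl refl J<J) = refl

    products-nonneg : ∀ p q → 0ℤ ≤ weight z α β p q * Γ p q
    products-nonneg p q with Γ p q ℤ.≟ 0ℤ
    ... | yes Γpq≡0 = *0-nonneg (weight z α β p q) Γpq≡0
    ... | no  Γpq≢0 = by-cases (z p ≟ J) (z q ≟ J) (p ≤? t) (q ≤? t) (J <? z q)
      where
      zp<zq : z p F.< z q
      zp<zq = increasing Γpq≢0
      by-cases : (Jp : Dec (z p ≡ J)) (Jq : Dec (z q ≡ J)) (p≤t? : Dec (p F.≤ t)) (q≤t? : Dec (q F.≤ t))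
                 (J<zq? : Dec (J F.< z q)) →
                 0ℤ ≤ (𝟙 (Jp ×-dec p≤t?) + 𝟙 (Jq ×-dec q≤t?) + - 𝟙 (Jp ×-dec J<zq?)) * Γ p q
      by-cases (yes zp≡J) (yes zq≡J) _        _        _         =
        contradiction (trans zp≡J (sym zq≡J)) (F.<⇒≢ zp<zq)
      by-cases (no  _)    (no  _)    _        _        _         = ℤ.≤-refl
      by-cases (no  _)    (yes zq≡J) _        (yes q≤t) _        = 1*-nonneg (nonneg-below zq≡J q≤t)
      by-cases (no  _)    (yes _)    _        (no  _)  _         = ℤ.≤-refl
      by-cases (yes zp≡J) (no  _)    _        _        (no J≮zq) = contradiction (subst (F._< z q) zp≡J zp<zq) J≮zq
      by-cases (yes _)    (no  _)    (yes _)  _        (yes _)   = ℤ.≤-refl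
      by-cases (yes zp≡J) (no  _)    (no p≰t) _        (yes _)   = -1*-nonneg (ℤ.≮⇒≥ (λ Γpq>0 → witness-free
        (nonIntersecting-outside s<t (inj₂ t<p) (inj₂ (F.<-trans t<p (upper Γpq≢0))) ,
         tgt-src (sym zp≡J) , both-positive Γst>0 Γpq>0)))
        where
        t<p : t F.< p
        t<p = ℕ.≰⇒> p≰t

-- The monochromatic and the heterochromatic case

module Heterochromatic {n k : ℕ} {z : Fin n → Fin k} (mono : NonDecreasing z) {Γ : Array n}
  (C : Counterexample z Γ) (increasing : ColourIncreasing z Γ) {a u : Fin n} (Γau>0 : 0ℤ < Γ a u)
  (a-least : ∀ {p q} → Γ p q ≢ 0ℤ → a F.≤ p) (u-least : ∀ {q} → Γ a q ≢ 0ℤ → u F.≤ q) where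

  open Counterexample C
  open Certificates mono C

  I J : Fin k
  I = z a
  J = z u

  a<u : a F.< u
  a<u = upper (>0⇒≢0 Γau>0)

  negative-at-a : ∃ λ w → Γ a w < 0ℤ
  negative-at-a = let (p , q , w≡1 , Γpq<0) = negative-entry α β 0or1 weight-au Γau>0 in at-a w≡1 Γpq<0
    where
    α : Fin n → ℤ
    α w = 𝟙 (w ≟ a)
    β : Fin k → Fin k → ℤ
    β _ _ = 0ℤ
    0or1 : ∀ {p q} → Γ p q ≢ 0ℤ → weight z α β p q ≡ 0ℤ ⊎ weight z α β p q ≡ 1ℤ
    0or1 {p} {q} Γpq≢0 with p ≟ a | q ≟ a
    ... | yes p≡a | yes q≡a = contradiction (trans p≡a (sym q≡a)) (F.<⇒≢ (upper Γpq≢0))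
    ... | yes _   | no  _   = inj₂ refl
    ... | no  _   | yes _   = inj₂ refl
    ... | no  _   | no  _   = inj₁ refl
    weight-au : weight z α β a u ≡ 1ℤ
    weight-au with a ≟ a | u ≟ a
    ... | yes _   | no  _   = refl
    ... | no  a≢a | _       = contradiction refl a≢a
    ... | yes _   | yes u≡a = contradiction (sym u≡a) (F.<⇒≢ a<u)
    at-a : ∀ {p q} → weight z α β p q ≡ 1ℤ → Γ p q < 0ℤ → ∃ λ w → Γ a w < 0ℤ
    at-a {p} {q} w≡1 Γpq<0 with p ≟ a | q ≟ a
    ... | yes refl | _        = q , Γpq<0
    ... | no  _    | yes refl = contradiction (a-least (<0⇒≢0 Γpq<0)) (ℕ.<⇒≱ (upper (<0⇒≢0 Γpq<0)))
    ... | no  _    | no  _    = contradiction w≡1 λ ()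

  NegativeIJ : Fin n → Set
  NegativeIJ y = z y ≡ J × ∃ λ x → z x ≡ I × Γ x y < 0ℤ

  negative-IJ : ∃ NegativeIJ
  negative-IJ = let (p , q , w≡1 , Γpq<0) = negative-entry α β 0or1 weight-au Γau>0 in at-IJ w≡1 Γpq<0
    where
    α : Fin n → ℤ
    α _ = 0ℤ
    β : Fin k → Fin k → ℤ
    β i j = 𝟙 ((i ≟ I) ×-dec (j ≟ J))
    0or1 : ∀ {p q} → Γ p q ≢ 0ℤ → weight z α β p q ≡ 0ℤ ⊎ weight z α β p q ≡ 1ℤ
    0or1 {p} {q} _ with z p ≟ I | z q ≟ J
    ... | yes _ | yes _ = inj₂ refl
    ... | yes _ | no  _ = inj₁ refl
    ... | no  _ | _     = inj₁ refl
    weight-au : weight z α β a u ≡ 1ℤ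
    weight-au with z a ≟ I | z u ≟ J
    ... | yes _  | yes _  = refl
    ... | no  ¬p | _      = contradiction refl ¬p
    ... | yes _  | no  ¬q = contradiction refl ¬q
    at-IJ : ∀ {p q} → weight z α β p q ≡ 1ℤ → Γ p q < 0ℤ → ∃ NegativeIJ
    at-IJ {p} {q} w≡1 Γpq<0 with z p ≟ I | z q ≟ J
    ... | yes zp≡I | yes zq≡J = q , zq≡J , p , zp≡I , Γpq<0
    ... | yes _    | no  _    = contradiction w≡1 λ ()
    ... | no  _    | _        = contradiction w≡1 λ ()

  least-negative-IJ : ∃ λ y → NegativeIJ y × (∀ {y₁} → NegativeIJ y₁ → y F.≤ y₁)
  least-negative-IJ = least (λ y → (z y ≟ J) ×-dec any? (λ x → (z x ≟ I) ×-dec (Γ x y ℤ.<? 0ℤ))) negative-IJ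

  module _ {x′ y′ : Fin n} (zx′≡I : z x′ ≡ I) (zy′≡J : z y′ ≡ J) (Γx′y′<0 : Γ x′ y′ < 0ℤ)
           (y′-least : ∀ {y} → NegativeIJ y → y′ F.≤ y) where

    u≡y′-impossible : u ≡ y′ → ⊥
    u≡y′-impossible u≡y′ with negative-at-a
    ... | w , Γaw<0 = witness-free
      (nonIntersecting-nested (inj₁ (a<x′ , F.<-trans x′<u u<w)) (inj₁ (a<u , u<w)) ,
       src-src (sym zx′≡I) , both-negative Γaw<0 Γx′u<0)
      where
      Γx′u<0 : Γ x′ u < 0ℤ
      Γx′u<0 = subst (λ v → Γ x′ v < 0ℤ) (sym u≡y′) Γx′y′<0
      x′<u : x′ F.< u
      x′<u = upper (<0⇒≢0 Γx′u<0)
      u<w : u F.< w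
      u<w = F.≤∧≢⇒< (u-least (<0⇒≢0 Γaw<0))
                    (λ u≡w → ℤ.<-asym Γau>0 (subst (λ v → Γ a v < 0ℤ) (sym u≡w) Γaw<0))
      a<x′ : a F.< x′
      a<x′ = F.≤∧≢⇒< (a-least (<0⇒≢0 Γx′u<0))
                     (λ a≡x′ → ℤ.<-asym Γau>0 (subst (λ v → Γ v u < 0ℤ) (sym a≡x′) Γx′u<0))

    u<y′-impossible : u F.< y′ → ⊥
    u<y′-impossible u<y′ = threshold-certificate increasing Γau>0 nonneg-below
      where
      nonneg-below : ∀ {p q} → z q ≡ J → q F.≤ u → 0ℤ ≤ Γ p q
      nonneg-below {p} {q} zq≡J q≤u = ℤ.≮⇒≥ (not-negative (z p ≟ I))
        where
        q<y′ : q F.< y′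
        q<y′ = ℕ.≤-<-trans q≤u u<y′
        not-negative : Dec (z p ≡ I) → ¬ Γ p q < 0ℤ
        not-negative (yes zp≡I) Γpq<0 = ℕ.<⇒≱ q<y′ (y′-least (zq≡J , p , zp≡I , Γpq<0))
        not-negative (no  zp≢I) Γpq<0 = witness-free
          (nonIntersecting-nested (inj₁ (x′<p , F.<-trans p<q q<y′)) (inj₁ (F.<-trans x′<p p<q , q<y′)) ,
           tgt-tgt (trans zy′≡J (sym zq≡J)) , both-negative Γx′y′<0 Γpq<0)
          where
          p<q : p F.< q
          p<q = upper (<0⇒≢0 Γpq<0)
          x′<p : x′ F.< p
          x′<p = nonDecreasing-reflects-< mono (subst (F._< z p) (sym zx′≡I)
                   (F.≤∧≢⇒< (mono a p (a-least (<0⇒≢0 Γpq<0))) (λ I≡zp → zp≢I (sym I≡zp))))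

    -- The mirror image of the previous case: the threshold certificate for -γ at (x′, y′).
    y′<u-impossible : y′ F.< u → ⊥
    y′<u-impossible y′<u =
      Certificates.threshold-certificate mono (negate C) (negated-increasing {Γ = Γ} increasing)
        (ℤ.neg-mono-< Γx′y′<0) nonneg-below
      where
      nonneg-below : ∀ {p q} → z q ≡ z y′ → q F.≤ y′ → 0ℤ ≤ - Γ p q
      nonneg-below {p} {q} zq≡zy′ q≤y′ = ℤ.neg-mono-≤ (ℤ.≮⇒≥ (not-positive (p ≟ a)))
        where
        q<u : q F.< u
        q<u = ℕ.≤-<-trans q≤y′ y′<u
        not-positive : Dec (p ≡ a) → ¬ 0ℤ < Γ p q
        not-positive (yes refl) Γaq>0 = ℕ.<⇒≱ q<u (u-least (>0⇒≢0 Γaq>0))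
        not-positive (no  p≢a)  Γpq>0 = witness-free
          (nonIntersecting-nested (inj₁ (a<p , F.<-trans p<q q<u)) (inj₁ (F.<-trans a<p p<q , q<u)) ,
           tgt-tgt (trans (sym zy′≡J) (sym zq≡zy′)) , both-positive Γau>0 Γpq>0)
          where
          p<q : p F.< q
          p<q = upper (>0⇒≢0 Γpq>0)
          a<p : a F.< p
          a<p = F.≤∧≢⇒< (a-least (>0⇒≢0 Γpq>0)) (λ a≡p → p≢a (sym a≡p))

  impossible : ⊥
  impossible with least-negative-IJ
  ... | y′ , (zy′≡J , x′ , zx′≡I , Γx′y′<0) , y′-least with F.<-cmp u y′
  ...   | tri< u<y′ _ _ = u<y′-impossible zx′≡I zy′≡J Γx′y′<0 y′-least u<y′
  ...   | tri≈ _ u≡y′ _ = u≡y′-impossible zx′≡I zy′≡J Γx′y′<0 y′-least u≡y′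
  ...   | tri> _ _ y′<u = y′<u-impossible zx′≡I zy′≡J Γx′y′<0 y′-least y′<u

module _ {n k : ℕ} {z : Fin n → Fin k} (mono : NonDecreasing z) {Γ : Array n} (C : Counterexample z Γ) where

  open Counterexample C

  MonochromaticSupport : Fin n → Fin n → Set
  MonochromaticSupport p q = z p ≡ z q × Γ p q ≢ 0ℤ

  monochromaticSupport? : ∀ p q → Dec (MonochromaticSupport p q)
  monochromaticSupport? p q = (z p ≟ z q) ×-dec ¬? (Γ p q ℤ.≟ 0ℤ)

  monochromatic : ∃₂ MonochromaticSupport → ⊥
  monochromatic some-pair with greatest (λ p → any? (monochromaticSupport? p)) some-pair
  ... | xm , xm-pair , xm-greatest with least (monochromaticSupport? xm) xm-pair
  ...   | ym , (zxm≡zym , Γ≢0) , ym-least = sign-split (ℤ.<-cmp (Γ xm ym) 0ℤ)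
    where
    sole : ∀ {p q} → xm F.≤ p × q F.≤ ym → Γ p q ≢ 0ℤ → p ≡ xm × q ≡ ym
    sole {p} {q} (xm≤p , q≤ym) Γpq≢0 = p≡xm , q≡ym
      where
      zp≡zq : z p ≡ z q
      zp≡zq = F.≤-antisym (mono p q (ℕ.<⇒≤ (upper Γpq≢0)))
                          (F.≤-trans (mono q ym q≤ym) (subst (F._≤ z p) zxm≡zym (mono xm p xm≤p)))
      p≡xm : p ≡ xm
      p≡xm = F.≤-antisym (xm-greatest (q , zp≡zq , Γpq≢0)) xm≤p
      q≡ym : q ≡ ym
      q≡ym = F.≤-antisym q≤ym (ym-least (subst (λ x → MonochromaticSupport x q) p≡xm (zp≡zq , Γpq≢0)))

    sign-split : Tri (Γ xm ym < 0ℤ) (Γ xm ym ≡ 0ℤ) (0ℤ < Γ xm ym) → ⊥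
    sign-split (tri< Γ<0 _ _) = Certificates.interval-certificate mono (negate C) zxm≡zym (ℤ.neg-mono-< Γ<0)
      (λ xm≤p q≤ym → sole-entry⇒nonneg (λ r h → sole r (negated-support {Γ = Γ} h)) (ℤ.neg-mono-< Γ<0)
                                       (xm≤p , q≤ym))
    sign-split (tri≈ _ Γ≡0 _) = Γ≢0 Γ≡0
    sign-split (tri> _ _ Γ>0) = Certificates.interval-certificate mono C zxm≡zym Γ>0
      (λ xm≤p q≤ym → sole-entry⇒nonneg sole Γ>0 (xm≤p , q≤ym))

  heterochromatic : ColourIncreasing z Γ → ⊥
  heterochromatic increasing with least (λ p → any? (λ q → ¬? (Γ p q ℤ.≟ 0ℤ))) support
  ... | a , a-row , a-least′ with least (λ q → ¬? (Γ a q ℤ.≟ 0ℤ)) a-row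
  ...   | u , Γau≢0 , u-least = sign-split (ℤ.<-cmp (Γ a u) 0ℤ)
    where
    a-least : ∀ {p q} → Γ p q ≢ 0ℤ → a F.≤ p
    a-least {q = q} Γpq≢0 = a-least′ (q , Γpq≢0)

    sign-split : Tri (Γ a u < 0ℤ) (Γ a u ≡ 0ℤ) (0ℤ < Γ a u) → ⊥
    sign-split (tri< Γau<0 _ _) = Heterochromatic.impossible mono (negate C) (negated-increasing {Γ = Γ} increasing)
      (ℤ.neg-mono-< Γau<0) (λ h → a-least (negated-support {Γ = Γ} h)) (λ h → u-least (negated-support {Γ = Γ} h))
    sign-split (tri≈ _ Γau≡0 _) = Γau≢0 Γau≡0
    sign-split (tri> _ _ Γau>0) = Heterochromatic.impossible mono C increasing Γau>0 a-least u-least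

  no-counterexample : ⊥
  no-counterexample with any? (λ p → any? (monochromaticSupport? p))
  ... | yes some-pair = monochromatic some-pair
  ... | no  none      = heterochromatic λ {p} {q} Γpq≢0 →
    F.≤∧≢⇒< (mono p q (ℕ.<⇒≤ (upper Γpq≢0))) (λ zp≡zq → none (p , q , zp≡zq , Γpq≢0))

-- From a witness to the two variables

module _ {n : ℕ} where

  Joins : Edge n → Fin n → Fin n → Set
  Joins ((a , b) , _) u v = (a ≡ u × b ≡ v) ⊎ (a ≡ v × b ≡ u)

  joins⇒≢ : {e : Edge n} {u v : Fin n} → Joins e u v → u ≢ v
  joins⇒≢ {(a , b) , a<b} (inj₁ (refl , refl)) = F.<⇒≢ a<b
  joins⇒≢ {(a , b) , a<b} (inj₂ (refl , refl)) = λ b≡a → F.<⇒≢ a<b (sym b≡a)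

  joins-unique : {e e′ : Edge n} {u v : Fin n} → Joins e u v → Joins e′ u v → e ≡ e′
  joins-unique {(a , b) , a<b} {_ , a<b′} (inj₁ (refl , refl)) (inj₁ (refl , refl)) =
    cong ((a , b) ,_) (F.<-irrelevant a<b a<b′)
  joins-unique {_ , a<b} {_ , b<a}  (inj₁ (refl , refl)) (inj₂ (refl , refl)) = contradiction b<a (F.<-asym a<b)
  joins-unique {_ , a<b} {_ , b<a}  (inj₂ (refl , refl)) (inj₁ (refl , refl)) = contradiction b<a (F.<-asym a<b)
  joins-unique {(a , b) , a<b} {_ , a<b′} (inj₂ (refl , refl)) (inj₂ (refl , refl)) =
    cong ((a , b) ,_) (F.<-irrelevant a<b a<b′)

  joins-disjoint : {e : Edge n} {u v u′ v′ : Fin n} → NonIntersecting u v u′ v′ → Joins e u v → ¬ Joins e u′ v′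
  joins-disjoint (u≢u′ , _ , _ , _ , _) (inj₁ (refl , refl)) (inj₁ (refl , _)) = u≢u′ refl
  joins-disjoint (_ , u≢v′ , _ , _ , _) (inj₁ (refl , refl)) (inj₂ (refl , _)) = u≢v′ refl
  joins-disjoint (_ , _ , v≢u′ , _ , _) (inj₂ (refl , refl)) (inj₁ (refl , _)) = v≢u′ refl
  joins-disjoint (_ , _ , _ , v≢v′ , _) (inj₂ (refl , refl)) (inj₂ (refl , _)) = v≢v′ refl

  var-joins : (u v : Fin n) (e : Edge n) → var u v e ≡ 0 ⊎ (var u v e ≡ 1 × Joins e u v)
  var-joins u v ((a , b) , _) with a ≟ u | b ≟ v | a ≟ v | b ≟ u
  ... | yes a≡u | yes b≡v | _       | _       = inj₂ (refl , inj₁ (a≡u , b≡v))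
  ... | yes _   | no  _   | yes a≡v | yes b≡u = inj₂ (refl , inj₂ (a≡v , b≡u))
  ... | yes _   | no  _   | yes _   | no  _   = inj₁ refl
  ... | yes _   | no  _   | no  _   | _       = inj₁ refl
  ... | no  _   | _       | yes a≡v | yes b≡u = inj₂ (refl , inj₂ (a≡v , b≡u))
  ... | no  _   | _       | yes _   | no  _   = inj₁ refl
  ... | no  _   | _       | no  _   | _       = inj₁ refl

  var·var-divides : (m : Monomial n) {e₁ e₂ : Edge n} {u v u′ v′ : Fin n} →
    Joins e₁ u v → Joins e₂ u′ v′ → NonIntersecting u v u′ v′ → 1 ℕ.≤ m e₁ → 1 ℕ.≤ m e₂ →
    (var u v · var u′ v′) ∣ₘ m
  var·var-divides m {u = u} {v} {u′} {v′} e₁-joins e₂-joins disjoint m₁ m₂ e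
    with var-joins u v e | var-joins u′ v′ e
  ... | inj₁ uv≡0      | inj₁ u′v′≡0       rewrite uv≡0 | u′v′≡0 = z≤n
  ... | inj₂ (uv≡1 , j) | inj₁ u′v′≡0       rewrite uv≡1 | u′v′≡0 =
    subst (λ e → 1 ℕ.≤ m e) (joins-unique e₁-joins j) m₁
  ... | inj₁ uv≡0      | inj₂ (u′v′≡1 , j′) rewrite uv≡0 | u′v′≡1 =
    subst (λ e → 1 ℕ.≤ m e) (joins-unique e₂-joins j′) m₂
  ... | inj₂ (_ , j)   | inj₂ (_ , j′)      = contradiction j′ (joins-disjoint {e = e} disjoint j)

pos-≥1 : {x : ℤ} → 0ℤ < x → 1 ℕ.≤ ∣ x ⊔ 0ℤ ∣
pos-≥1 {+[1+ _ ]} _          = s≤s z≤n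
pos-≥1 {ℤ.+ 0}   (ℤ.+<+ ())

neg-≥1 : {x : ℤ} → x < 0ℤ → 1 ℕ.≤ ∣ (- x) ⊔ 0ℤ ∣
neg-≥1 { -[1+ _ ]} _          = s≤s z≤n
neg-≥1 {ℤ.+ _}    (ℤ.+<+ ())

module _ {n k : ℕ} {z : Fin n → Fin k} where

  orient : {p q p′ q′ : Fin n} (p<q : p F.< q) (p′<q′ : p′ F.< q′) →
    NonIntersecting p q p′ q′ → ColourShared z p q p′ q′ →
    ∃ λ u → ∃ λ v → ∃ λ u′ → ∃ λ v′ →
      Joins ((p , q) , p<q) u v × Joins ((p′ , q′) , p′<q′) u′ v′ × NonIntersecting u v u′ v′ × z u ≡ z u′
  orient _ _ disjoint (src-src zp≡zp′) =
    _ , _ , _ , _ , inj₁ (refl , refl) , inj₁ (refl , refl) , disjoint , zp≡zp′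
  orient _ _ disjoint (src-tgt zp≡zq′) =
    _ , _ , _ , _ , inj₁ (refl , refl) , inj₂ (refl , refl) , nonIntersecting-swapʳ disjoint , zp≡zq′
  orient _ _ disjoint (tgt-src zq≡zp′) =
    _ , _ , _ , _ , inj₂ (refl , refl) , inj₁ (refl , refl) , nonIntersecting-swapˡ disjoint , zq≡zp′
  orient _ _ disjoint (tgt-tgt zq≡zq′) =
    _ , _ , _ , _ , inj₂ (refl , refl) , inj₂ (refl , refl) ,
    nonIntersecting-swapˡ (nonIntersecting-swapʳ disjoint) , zq≡zq′

  witness-exists : NonDecreasing z → {Γ : Array n} → (∀ {p q} → Γ p q ≢ 0ℤ → p F.< q) → Balanced z Γ →
    ∃₂ (λ s t → Γ s t ≢ 0ℤ) → ∃ λ p → ∃ λ q → ∃ λ p′ → ∃ λ q′ → Witness z Γ p q p′ q′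
  witness-exists mono {Γ} upper balanced support
    with any? (λ p → any? (λ q → any? (λ p′ → any? (λ q′ → witness? z Γ p q p′ q′))))
  ... | yes found = found
  ... | no  none  = ⊥-elim (no-counterexample mono record
    { upper = upper ; balanced = balanced ; witness-free = λ w → none (_ , _ , _ , _ , w) ; support = support })

  witness⇒monomials : (γ : Edge n → ℤ) {p q p′ q′ : Fin n} → Witness z (extend γ) p q p′ q′ →
    ∃ λ u → ∃ λ v → ∃ λ u′ → ∃ λ v′ →
      (u ≢ v) × (u′ ≢ v′) × NonIntersecting u v u′ v′ × (z u ≡ z u′) ×
      (((var u v · var u′ v′) ∣ₘ pos γ) ⊎ ((var u v · var u′ v′) ∣ₘ neg γ))
  witness⇒monomials γ {p} {q} {p′} {q′} (disjoint , shared , same-sign)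
    with extend-upper γ (proj₁ (sameSign⇒≢0 same-sign)) | extend-upper γ (proj₂ (sameSign⇒≢0 same-sign))
  ... | p<q | p′<q′ with orient p<q p′<q′ disjoint shared
  ...   | u , v , u′ , v′ , uv-joins , u′v′-joins , disjoint′ , zu≡zu′ =
    u , v , u′ , v′ , joins⇒≢ {e = (p , q) , p<q} uv-joins , joins⇒≢ {e = (p′ , q′) , p′<q′} u′v′-joins ,
    disjoint′ , zu≡zu′ , divides same-sign
    where
    divides : SameSign (extend γ p q) (extend γ p′ q′) →
              ((var u v · var u′ v′) ∣ₘ pos γ) ⊎ ((var u v · var u′ v′) ∣ₘ neg γ)
    divides (both-positive x>0 y>0) = inj₁ (var·var-divides (pos γ) uv-joins u′v′-joins disjoint′
      (pos-≥1 (subst (0ℤ <_) (extend-edge γ p<q) x>0)) (pos-≥1 (subst (0ℤ <_) (extend-edge γ p′<q′) y>0)))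
    divides (both-negative x<0 y<0) = inj₂ (var·var-divides (neg γ) uv-joins u′v′-joins disjoint′
      (neg-≥1 (subst (_< 0ℤ) (extend-edge γ p<q) x<0)) (neg-≥1 (subst (_< 0ℤ) (extend-edge γ p′<q′) y<0)))

proposition4p6 : (n k : ℕ) (z : Fin n → Fin k) → NonDecreasing z →
    (γ : Edge n → ℤ) → InKernel z γ → (∃ λ e → γ e ≢ 0ℤ) →
    ∃ λ u → ∃ λ v → ∃ λ u' → ∃ λ v' →
      (u ≢ v) × (u' ≢ v') × NonIntersecting u v u' v' × (z u ≡ z u') ×
      (((var u v · var u' v') ∣ₘ pos γ) ⊎ ((var u v · var u' v') ∣ₘ neg γ))
proposition4p6 n k z mono γ γ∈ker (((s , t) , s<t) , γe≢0) =
  let (_ , _ , _ , _ , witness) = witness-exists mono (extend-upper γ) (inKernel⇒balanced mono γ∈ker) (s , t , Γst≢0)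
  in witness⇒monomials γ witness
  where
  Γst≢0 : extend γ s t ≢ 0ℤ
  Γst≢0 = γe≢0 ∘ trans (sym (extend-edge γ s<t))
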